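{- There is an absolute constant $C$ such that the following holds. Let $G=(V,E)$ be a bipartite undirected unweighted graph on $n$ nodes, let $P$ be a set of $p$ node pairs, let $\pi$ be a shortest path tiebreaking scheme that is lazy for $P$, and let $E_H=\pi(P)$. Then $|E_H|\le C\left(p+\frac{n^2}{\mathrm{rs}(n)}\right)$.
   Context: A shortest path tiebreaking scheme maps each ordered pair $(s,t)$ to a shortest $s$–$t$ path in $G$; $\pi(Q)$ is the union of the edge sets of $\pi(q)$, $q\in Q$. $P_s=\{(s,t)\in P\}$ and $T_s=(V,\pi(P_s))$. In a tree rooted at $s$ with edges oriented away from $s$, a branching node has out-degree at least 2, branching edges are those leaving branching nodes, and $\mathcal{B}(T)$ is the set of branching edges. $\pi$ is lazy for $P$ if (1) each $T_s$ is a tree rooted at $s$ (possibly plus isolated nodes) and (2) for all $s$ and distinct edges $(x,y),(x',y')\in T_s\setminus\mathcal{B}(T_s)$ with $\mathrm{dist}_G(s,y)=\mathrm{dist}_G(s,y')=\mathrm{dist}_G(s,x)+1=\mathrm{dist}_G(s,x')+1$, $(x,y')\notin E$ and $(x',y)\notin E$. An induced matching of a graph is a matching $E'$ such that for some node set $S$ the induced subgraph on $S$ has edge set exactly $E'$. A graph on $n$ nodes is a Ruzsa–Szemerédi graph if its edges can be partitioned into at most $n$ induced matchings; $\mathrm{rs}(n)$ is the largest value such that every Ruzsa–Szemerédi graph on $n$ nodes has at most $n^2/\mathrm{rs}(n)$ edges. -}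

module Defs where

open import Data.Nat using (ℕ; zero; suc; _+_; _*_; _≤_; _<ᵇ_)
open import Data.Fin using (Fin; toℕ; _≟_)
open import Data.Bool using (Bool; true; false; T; _∧_; _∨_; if_then_else_; not)
open import Data.List using (List; []; _∷_; map; allFin)
open import Data.Nat.ListAction using (sum)
open import Data.Bool.ListAction using (any)
open import Data.List.Relation.Unary.Unique.Propositional using (Unique)
open import Data.Product using (Σ; ∃; _×_; _,_; proj₁; proj₂)
open import Data.Sum using (_⊎_)
open import Relation.Nullary using (¬_; Dec; yes; no; does)
open import Relation.Binary.PropositionalEquality using (_≡_; _≢_)
open import Function.Bundles using (_⇔_)

record Graph (n : ℕ) : Set where
  field
    adj    : Fin n → Fin n → Bool
    sym    : ∀ u v → adj u v ≡ adj v u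
    irrefl : ∀ u → adj u u ≡ false
open Graph public

Adj : ∀ {n} → Graph n → Fin n → Fin n → Set
Adj G u v = T (adj G u v)

Bipartite : ∀ {n} → Graph n → Set
Bipartite {n} G = Σ (Fin n → Bool) λ col → ∀ u v → Adj G u v → col u ≢ col v

-- number of unordered pairs {u,v} (u ≠ v) satisfying a Bool predicate,
-- counted via u < v
countPairs : ∀ {n} → (Fin n → Fin n → Bool) → ℕ
countPairs {n} f =
  sum (map (λ u → sum (map (λ v → if (toℕ u <ᵇ toℕ v) ∧ f u v then 1 else 0)
                           (allFin n)))
           (allFin n))

countOrdered : ∀ {n} → (Fin n → Fin n → Bool) → ℕ
countOrdered {n} f =
  sum (map (λ u → sum (map (λ v → if f u v then 1 else 0) (allFin n)))
           (allFin n))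

edgeCount : ∀ {n} → Graph n → ℕ
edgeCount G = countPairs (adj G)

data Walk {n : ℕ} (R : Fin n → Fin n → Set) : Fin n → Fin n → ℕ → Set where
  nil  : ∀ {u} → Walk R u u 0
  cons : ∀ {u v t k} → R u v → Walk R v t k → Walk R u t (suc k)

vertsTail : ∀ {n R u t k} → Walk {n} R u t k → List (Fin n)
vertsTail nil = []
vertsTail (cons {v = v} _ w) = v ∷ vertsTail w

walkEdges : ∀ {n R u t k} → Walk {n} R u t k → List (Fin n × Fin n)
walkEdges nil = []
walkEdges (cons {u = u} {v = v} _ w) = (u , v) ∷ walkEdges w

Dist : ∀ {n} → (Fin n → Fin n → Set) → Fin n → Fin n → ℕ → Set
Dist R s t d = Walk R s t d × (∀ k → Walk R s t k → d ≤ k)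

ShortestPath : ∀ {n} → Graph n → Fin n → Fin n → Set
ShortestPath G s t = Σ ℕ λ d → Σ (Walk (Adj G) s t d) λ w →
                       ∀ k → Walk (Adj G) s t k → d ≤ k

onPath : ∀ {n} {G : Graph n} {s t} → ShortestPath G s t → Fin n → Fin n → Bool
onPath (_ , w , _) u v =
  any (λ e → (does (proj₁ e ≟ u) ∧ does (proj₂ e ≟ v))
           ∨ (does (proj₁ e ≟ v) ∧ does (proj₂ e ≟ u)))
      (walkEdges w)

-- Demand pairs and tiebreaking schemes.
-- P is a set of ordered node pairs (a Bool-valued predicate);
-- a tiebreaking scheme (on P) assigns to each (s,t) ∈ P a shortest s–t path.

Pairs : ℕ → Set
Pairs n = Fin n → Fin n → Bool

Scheme : ∀ {n} → Graph n → Pairs n → Set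
Scheme {n} G P = (s t : Fin n) → T (P s t) → ShortestPath G s t

onSchemePath : ∀ {n} {G : Graph n} {s t : Fin n} (b : Bool) →
               (T b → ShortestPath G s t) → Fin n → Fin n → Bool
onSchemePath {G = G} true  f u v = onPath {G = G} (f _) u v
onSchemePath false f u v = false

inπP : ∀ {n} (G : Graph n) (P : Pairs n) → Scheme G P → Fin n → Fin n → Bool
inπP {n} G P π u v =
  any (λ s → any (λ t → onSchemePath {G = G} (P s t) (π s t) u v) (allFin n)) (allFin n)

inπPs : ∀ {n} (G : Graph n) (P : Pairs n) → Scheme G P → Fin n → Fin n → Fin n → Bool
inπPs {n} G P π s u v =
  any (λ t → onSchemePath {G = G} (P s t) (π s t) u v) (allFin n)

TsEdge : ∀ {n} (G : Graph n) (P : Pairs n) → Scheme G P → Fin n → Fin n → Fin n → Set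
TsEdge G P π s u v = T (inπPs G P π s u v)

NonIsolated : ∀ {n} → (Fin n → Fin n → Set) → Fin n → Set
NonIsolated R u = ∃ λ v → R u v

HasCycle : ∀ {n} → (Fin n → Fin n → Set) → Set
HasCycle {n} R = Σ (Fin n) λ v → Σ ℕ λ k → Σ (Walk R v v k) λ w →
                   (3 ≤ k) × Unique (vertsTail w)

-- the graph (V,R) is a tree containing s, plus possibly isolated nodes:
-- every non-isolated node is connected to s, and there is no cycle
RootedTree : ∀ {n} → (Fin n → Fin n → Set) → Fin n → Set
RootedTree R s = (∀ u → NonIsolated R u → ∃ λ k → Walk R s u k) × ¬ HasCycle R

-- orientation away from the root s: (x,y) is an edge of the tree with
-- y one step farther from s than x (in the tree)
Oriented : ∀ {n} → (Fin n → Fin n → Set) → Fin n → Fin n → Fin n → Set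
Oriented R s x y = R x y × ∃ λ d → Dist R s x d × Dist R s y (suc d)

Branching : ∀ {n} → (Fin n → Fin n → Set) → Fin n → Fin n → Set
Branching R s x = ∃ λ y → ∃ λ y' → y ≢ y' × Oriented R s x y × Oriented R s x y'

NonBranchingEdge : ∀ {n} → (Fin n → Fin n → Set) → Fin n → Fin n → Fin n → Set
NonBranchingEdge R s x y = Oriented R s x y × ¬ Branching R s x

Lazy : ∀ {n} (G : Graph n) (P : Pairs n) → Scheme G P → Set
Lazy {n} G P π =
  (∀ s → RootedTree (TsEdge G P π s) s) ×
  (∀ s x y x' y' →
     NonBranchingEdge (TsEdge G P π s) s x y →
     NonBranchingEdge (TsEdge G P π s) s x' y' →
     (x , y) ≢ (x' , y') →
     ∀ d → Dist (Adj G) s y (suc d) → Dist (Adj G) s y' (suc d) →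
           Dist (Adj G) s x d → Dist (Adj G) s x' d →
     ¬ Adj G x y' × ¬ Adj G x' y)

InducedMatchingClass : ∀ {n} (H : Graph n) →
  ((u v : Fin n) → Adj H u v → Fin n) → Fin n → Set
InducedMatchingClass {n} H c i =
  (∀ u v w (h : Adj H u v) (h' : Adj H u w) → c u v h ≡ i → c u w h' ≡ i → v ≡ w) ×
  -- induced: some node set S spans exactly the edges of class i
  (Σ (Fin n → Bool) λ S → ∀ u v (h : Adj H u v) →
      (T (S u) × T (S v)) ⇔ (c u v h ≡ i))

-- edges partitioned into at most n induced matchings (classes indexed by Fin n,
-- some possibly empty)
IsRS : ∀ {n} → Graph n → Set
IsRS {n} H = Σ ((u v : Fin n) → Adj H u v → Fin n) λ c →
  (∀ u v (h : Adj H u v) (h' : Adj H v u) → c u v h ≡ c v u h') ×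
  (∀ i → InducedMatchingClass H c i)

-- Fix a source s. The routes π(s,t), (s,t) ∈ P, form the tree T_s, and since they are shortest
-- paths every edge of π(P) is a step x → y of some T_s from BFS level d to level d + 1.
--
-- Steps out of branching nodes are charged to demands. Let the first target of a node v be the
-- first t whose route from s visits v. Along a route, the nodes whose first target is the route's
-- own target form a final segment, so a step at which the first target switches is determined by
-- that target; a branching step that keeps the first target has a sibling step that switches it.
-- Hence T_s has at most 2|P_s| branching steps.
--
-- The non-branching steps at levels ≡ r (mod 3) form a graph H_r, each edge coloured by a source
-- whose tree contains it. A colour class is a matching, as non-branching nodes have one child and
-- nodes of the tree T_s one parent. It is induced: in a bipartite graph adjacent nodes lie on
-- consecutive levels, the residues mod 3 then force two class edges joined by an edge e to start
-- on the same level, and laziness forbids e unless it is one of them. So each H_r is a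
-- Ruzsa–Szemerédi graph, and |π(P)| ≤ 2p + 2p + 3m ≤ 4(p + m).

module Submission where

open import Defs hiding (sym)
open import Algebra.Properties.CommutativeSemigroup using (interchange)
open import Data.Bool using (Bool; true; false; T; _∧_; _∨_; not; if_then_else_)
open import Data.Bool.ListAction using (any; or)
open import Data.Bool.Properties using (T-irrelevant; ∨-comm; ∨-idem)
open import Data.Empty using (⊥; ⊥-elim)
open import Data.Fin using (Fin; zero; suc; toℕ; _≟_)
open import Data.List using (List; []; _∷_; _++_; map; allFin; upTo; findᵇ)
open import Data.Maybe using (Maybe; just; fromMaybe)
open import Data.Maybe.Properties using (≡-dec)
open import Data.List.Membership.Propositional using (_∈_; find; lose)
open import Data.List.Membership.Propositional.Properties using (∈-allFin; ∈-upTo⁺; ∈-upTo⁻)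
open import Data.List.Properties using (map-cong)
open import Data.List.Relation.Unary.All as All using (All; []; _∷_)
open import Data.List.Relation.Unary.All.Properties as Allₚ using ()
open import Data.List.Relation.Unary.AllPairs.Properties as AllPairs using ()
open import Data.List.Relation.Unary.Any using (here; there)
open import Data.List.Relation.Unary.Any.Properties using (any⁺; any⁻)
open import Data.List.Relation.Unary.Unique.Propositional using (Unique; []; _∷_)
open import Data.List.Relation.Unary.Unique.Propositional.Properties using (allFin⁺)
open import Data.Nat using (ℕ; zero; suc; _+_; _*_; _∸_; _≤_; _<_; z≤n; s≤s; _<ᵇ_)
open import Data.Nat.GeneralisedArithmetic using (iterate)
open import Data.Nat.ListAction using (sum)
open import Data.Nat.Properties hiding (_≟_)
open import Data.Product using (Σ; ∃; _×_; _,_; proj₁; proj₂)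
open import Data.Sum using (_⊎_; inj₁; inj₂; [_,_]; map₂)
open import Relation.Binary.Definitions using (tri<; tri≈; tri>)
open import Function using (_∘_; mk⇔)
open import Data.Nat.Tactic.RingSolver using (solve-∀)
open import Relation.Binary.PropositionalEquality using (_≡_; _≢_; refl; sym; trans; cong; subst; subst₂)
open import Relation.Nullary using (¬_; Dec; does; yes; no)
open import Relation.Nullary.Decidable using (T?)

¬T⇒≡false : ∀ {b} → ¬ T b → b ≡ false
¬T⇒≡false {true}  ¬b = ⊥-elim (¬b _)
¬T⇒≡false {false} _  = refl

T-∨⁺ˡ : ∀ {a b} → T a → T (a ∨ b)
T-∨⁺ˡ {true} _ = _

T-∨⁺ʳ : ∀ a {b} → T b → T (a ∨ b)
T-∨⁺ʳ true  _  = _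
T-∨⁺ʳ false tb = tb

T-∨⁻ : ∀ a {b} → T (a ∨ b) → T a ⊎ T b
T-∨⁻ true  ta = inj₁ ta
T-∨⁻ false tb = inj₂ tb

T-∧⁺ : ∀ {a b} → T a → T b → T (a ∧ b)
T-∧⁺ {true} _ tb = tb

T-∧⁻ : ∀ {a b} → T (a ∧ b) → T a × T b
T-∧⁻ {true} tb = _ , tb

_==_ : ∀ {n} → Fin n → Fin n → Bool
a == b = does (a ≟ b)

module _ {A : Set} where

  does⁺ : ∀ (d : Dec A) → A → T (does d)
  does⁺ (yes _) _ = _
  does⁺ (no ¬a) a = ¬a a

  does⁻ : ∀ (d : Dec A) → T (does d) → A
  does⁻ (yes a) _ = a

  not-does⁺ : ∀ (d : Dec A) → ¬ A → T (not (does d))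
  not-does⁺ (yes a) ¬a = ¬a a
  not-does⁺ (no _)  _  = _

  not-does⁻ : ∀ (d : Dec A) → T (not (does d)) → ¬ A
  not-does⁻ (no ¬a) _ = ¬a

==-refl : ∀ {n} (a : Fin n) → T (a == a)
==-refl a = does⁺ (a ≟ a) refl

==⇒≡ : ∀ {n} {a b : Fin n} → T (a == b) → a ≡ b
==⇒≡ {a = a} {b} = does⁻ (a ≟ b)

any-intro : ∀ {A : Set} (p : A → Bool) {xs : List A} {x} → x ∈ xs → T (p x) → T (any p xs)
any-intro p x∈xs px = any⁺ p (lose x∈xs px)

any-elim : ∀ {A : Set} (p : A → Bool) (xs : List A) → T (any p xs) → ∃ λ x → x ∈ xs × T (p x)
any-elim p xs h = find (any⁻ p xs h)

guarded : (b : Bool) → (T b → Bool) → Bool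
guarded true  f = f _
guarded false f = false

guarded⁺ : ∀ (b : Bool) (f : T b → Bool) (p : T b) → T (f p) → T (guarded b f)
guarded⁺ true f _ fp = fp

guarded⁻ : ∀ (b : Bool) (f : T b → Bool) → T (guarded b f) → Σ (T b) (T ∘ f)
guarded⁻ true f h = _ , h

module _ {A : Set} where

  findᵇ-sound : ∀ (p : A → Bool) xs {y} → findᵇ p xs ≡ just y → T (p y)
  findᵇ-sound p (x ∷ xs) eq with p x in px
  findᵇ-sound p (x ∷ xs) refl | true  = subst T (sym px) _
  ...                         | false = findᵇ-sound p xs eq

  findᵇ-complete : ∀ (p : A → Bool) {xs x} → x ∈ xs → T (p x) → ∃ λ y → findᵇ p xs ≡ just y
  findᵇ-complete p {x' ∷ xs} x∈ px with p x' in px'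
  ... | true = x' , refl
  findᵇ-complete p (here refl)  px | false = ⊥-elim (subst T px' px)
  findᵇ-complete p (there x∈xs) px | false = findᵇ-complete p x∈xs px

  fromMaybe-findᵇ : ∀ (p : A → Bool) {xs x} d → x ∈ xs → T (p x) → T (p (fromMaybe d (findᵇ p xs)))
  fromMaybe-findᵇ p {xs} d x∈ px with y , found ← findᵇ-complete p x∈ px rewrite found =
    findᵇ-sound p xs found

  findᵇ-⊆ : ∀ (f g : A → Bool) xs → (∀ x → T (f x) → T (g x)) →
            ∀ {l} → findᵇ g xs ≡ just l → T (f l) → findᵇ f xs ≡ just l
  findᵇ-⊆ f g (x ∷ xs) f⊆g eq fl with g x in gx | f x in fx
  findᵇ-⊆ f g (x ∷ xs) f⊆g refl fl | true  | true  = refl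
  findᵇ-⊆ f g (x ∷ xs) f⊆g refl fl | true  | false = ⊥-elim (subst T fx fl)
  ... | false | true  = ⊥-elim (subst T gx (f⊆g x (subst T (sym fx) _)))
  ... | false | false = findᵇ-⊆ f g xs f⊆g eq fl

  findᵇ-cong : ∀ {f g : A → Bool} xs → (∀ x → f x ≡ g x) → findᵇ f xs ≡ findᵇ g xs
  findᵇ-cong []       f≗g = refl
  findᵇ-cong (x ∷ xs) f≗g rewrite f≗g x | findᵇ-cong xs f≗g = refl

fromMaybe-injective : ∀ {A : Set} {m m' : Maybe A} {d d'} → (∃ λ a → m ≡ just a) → (∃ λ a → m' ≡ just a) →
                      fromMaybe d m ≡ fromMaybe d' m' → m ≡ m'
fromMaybe-injective (_ , refl) (_ , refl) same = cong just same

-- Finite sums and counting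

𝟙 : Bool → ℕ
𝟙 b = if b then 1 else 0

𝟙≤1 : ∀ b → 𝟙 b ≤ 1
𝟙≤1 true  = s≤s z≤n
𝟙≤1 false = z≤n

𝟙-T : ∀ {b} → T b → 1 ≤ 𝟙 b
𝟙-T {true} _ = s≤s z≤n

𝟙-positive : ∀ {b} → 1 ≤ 𝟙 b → T b
𝟙-positive {true} _ = _

∑ : {A : Set} → List A → (A → ℕ) → ℕ
∑ xs f = sum (map f xs)

module _ {A : Set} where

  ∑-cong : ∀ (xs : List A) {f g : A → ℕ} → (∀ x → f x ≡ g x) → ∑ xs f ≡ ∑ xs g
  ∑-cong xs f≗g = cong sum (map-cong f≗g xs)

  ∑-mono : ∀ (xs : List A) {f g : A → ℕ} → (∀ x → f x ≤ g x) → ∑ xs f ≤ ∑ xs g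
  ∑-mono []       f≤g = z≤n
  ∑-mono (x ∷ xs) f≤g = +-mono-≤ (f≤g x) (∑-mono xs f≤g)

  ∑-+ : ∀ (xs : List A) (f g : A → ℕ) → ∑ xs (λ x → f x + g x) ≡ ∑ xs f + ∑ xs g
  ∑-+ []       f g = refl
  ∑-+ (x ∷ xs) f g = trans (cong (f x + g x +_) (∑-+ xs f g))
                           (interchange +-commutativeSemigroup (f x) (g x) (∑ xs f) (∑ xs g))

  ∑-zero : ∀ (xs : List A) {f : A → ℕ} → (∀ x → f x ≡ 0) → ∑ xs f ≡ 0
  ∑-zero xs f≗0 = trans (∑-cong xs f≗0) (∑-const-0 xs)
    where
    ∑-const-0 : ∀ (xs : List A) → ∑ xs (λ _ → 0) ≡ 0
    ∑-const-0 []       = refl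
    ∑-const-0 (_ ∷ xs) = ∑-const-0 xs

  ∑-∈ : ∀ {xs : List A} (f : A → ℕ) {x} → x ∈ xs → f x ≤ ∑ xs f
  ∑-∈ f {x} (here refl) = m≤m+n (f x) _
  ∑-∈ f (there {x = y} x∈xs) = ≤-trans (∑-∈ f x∈xs) (m≤n+m _ (f y))

  ∑-positive : ∀ (xs : List A) (f : A → ℕ) → 1 ≤ ∑ xs f → ∃ λ x → 1 ≤ f x
  ∑-positive (x ∷ xs) f 1≤∑ with f x in fx≡
  ... | suc _ = x , subst (1 ≤_) (sym fx≡) (s≤s z≤n)
  ... | zero  = ∑-positive xs f 1≤∑

  ∑-atMostOne : ∀ (xs : List A) (f : A → ℕ) → Unique xs → (∀ x → f x ≤ 1) →
                (∀ x x' → 1 ≤ f x → 1 ≤ f x' → x ≡ x') → ∑ xs f ≤ 1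
  ∑-atMostOne []       f _            f≤1 unique = z≤n
  ∑-atMostOne (x ∷ xs) f (x∉xs ∷ uxs) f≤1 unique with f x in fx≡
  ... | zero  = ∑-atMostOne xs f uxs f≤1 unique
  ... | suc k = begin
    suc k + ∑ xs f  ≡⟨ cong (suc k +_) (∑-zero-on xs x∉xs) ⟩
    suc k + 0       ≡⟨ +-identityʳ (suc k) ⟩
    suc k           ≡⟨ fx≡ ⟨
    f x             ≤⟨ f≤1 x ⟩
    1               ∎
    where
    open ≤-Reasoning
    ∑-zero-on : ∀ ys → All (x ≢_) ys → ∑ ys f ≡ 0
    ∑-zero-on []       []            = refl
    ∑-zero-on (y ∷ ys) (x≢y ∷ x∉ys) with f y in fy≡
    ... | zero  = ∑-zero-on ys x∉ys
    ... | suc _ = ⊥-elim (x≢y (unique x y (subst (1 ≤_) (sym fx≡) (s≤s z≤n))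
                                          (subst (1 ≤_) (sym fy≡) (s≤s z≤n))))

  𝟙-any≤∑ : ∀ (p : A → Bool) (xs : List A) → 𝟙 (any p xs) ≤ ∑ xs (𝟙 ∘ p)
  𝟙-any≤∑ p []       = z≤n
  𝟙-any≤∑ p (x ∷ xs) with p x
  ... | true  = s≤s z≤n
  ... | false = 𝟙-any≤∑ p xs

∑-swap : ∀ {A B : Set} (xs : List A) (ys : List B) (f : A → B → ℕ) →
         ∑ xs (λ x → ∑ ys (f x)) ≡ ∑ ys (λ y → ∑ xs (λ x → f x y))
∑-swap []       ys f = sym (∑-zero ys (λ _ → refl))
∑-swap (x ∷ xs) ys f = trans (cong (∑ ys (f x) +_) (∑-swap xs ys f))
                             (sym (∑-+ ys (f x) (λ y → ∑ xs (λ x → f x y))))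

count : ∀ {n} → (Fin n → Bool) → ℕ
count {n} Q = ∑ (allFin n) (𝟙 ∘ Q)

𝟙-mono : ∀ {a b} → (T a → T b) → 𝟙 a ≤ 𝟙 b
𝟙-mono {false}         _   = z≤n
𝟙-mono {true}  {true}  _   = s≤s z≤n
𝟙-mono {true}  {false} a⇒b = ⊥-elim (a⇒b _)

𝟙-∨ : ∀ a b → 𝟙 (a ∨ b) ≤ 𝟙 a + 𝟙 b
𝟙-∨ true  _ = s≤s z≤n
𝟙-∨ false _ = ≤-refl

≤𝟙 : ∀ {m b} → m ≤ 1 → (1 ≤ m → T b) → m ≤ 𝟙 b
≤𝟙 {zero}          _   _      = z≤n
≤𝟙 {suc _} {true}  m≤1 _      = m≤1
≤𝟙 {suc _} {false} _   1≤m⇒b = ⊥-elim (1≤m⇒b (s≤s z≤n))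

module _ {n : ℕ} where

  count-==-1 : ∀ (a : Fin n) → count (a ==_) ≡ 1
  count-==-1 a = ≤-antisym
    (∑-atMostOne (allFin n) _ (allFin⁺ n) (λ _ → 𝟙≤1 _)
       (λ x x' p p' → trans (sym (==⇒≡ {a = a} (𝟙-positive p))) (==⇒≡ {a = a} (𝟙-positive p'))))
    (≤-trans (𝟙-T (==-refl a)) (∑-∈ (𝟙 ∘ (a ==_)) (∈-allFin a)))

  𝟙-fibres : ∀ (b : Bool) (a : Fin n) → 𝟙 b ≡ count (λ t → b ∧ (a == t))
  𝟙-fibres true  a = sym (count-==-1 a)
  𝟙-fibres false a = sym (∑-zero (allFin n) (λ _ → refl))

  countOrdered-mono : ∀ {f g : Fin n → Fin n → Bool} → (∀ u v → T (f u v) → T (g u v)) →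
                      countOrdered f ≤ countOrdered g
  countOrdered-mono f⇒g = ∑-mono (allFin n) (λ u → ∑-mono (allFin n) (λ v → 𝟙-mono (f⇒g u v)))

  countOrdered-∨ : ∀ (f g : Fin n → Fin n → Bool) →
                   countOrdered (λ u v → f u v ∨ g u v) ≤ countOrdered f + countOrdered g
  countOrdered-∨ f g = begin
    countOrdered (λ u v → f u v ∨ g u v)
      ≤⟨ ∑-mono (allFin n) (λ u → ∑-mono (allFin n) (λ v → 𝟙-∨ (f u v) (g u v))) ⟩
    ∑ (allFin n) (λ u → ∑ (allFin n) (λ v → 𝟙 (f u v) + 𝟙 (g u v)))
      ≡⟨ ∑-cong (allFin n) (λ u → ∑-+ (allFin n) _ _) ⟩
    ∑ (allFin n) (λ u → ∑ (allFin n) (𝟙 ∘ f u) + ∑ (allFin n) (𝟙 ∘ g u))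
      ≡⟨ ∑-+ (allFin n) _ _ ⟩
    countOrdered f + countOrdered g ∎
    where open ≤-Reasoning

  countOrdered-flip : ∀ (f : Fin n → Fin n → Bool) → countOrdered (λ u v → f v u) ≡ countOrdered f
  countOrdered-flip f = ∑-swap (allFin n) (allFin n) (λ u v → 𝟙 (f v u))

  countOrdered-any : ∀ {I : Set} (is : List I) (f : I → Fin n → Fin n → Bool) →
    countOrdered (λ u v → any (λ i → f i u v) is) ≤ ∑ is (λ i → countOrdered (f i))
  countOrdered-any is f = begin
    countOrdered (λ u v → any (λ i → f i u v) is)
      ≤⟨ ∑-mono (allFin n) (λ u → ∑-mono (allFin n) (λ v → 𝟙-any≤∑ (λ i → f i u v) is)) ⟩
    ∑ (allFin n) (λ u → ∑ (allFin n) (λ v → ∑ is (λ i → 𝟙 (f i u v))))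
      ≡⟨ ∑-cong (allFin n) (λ u → ∑-swap (allFin n) is (λ v i → 𝟙 (f i u v))) ⟩
    ∑ (allFin n) (λ u → ∑ is (λ i → ∑ (allFin n) (𝟙 ∘ f i u)))
      ≡⟨ ∑-swap (allFin n) is (λ u i → ∑ (allFin n) (𝟙 ∘ f i u)) ⟩
    ∑ is (λ i → countOrdered (f i)) ∎
    where open ≤-Reasoning

  -- Split the pairs by the value of g; each fibre holds at most one pair.
  countOrdered-injection : ∀ (A : Fin n → Fin n → Bool) (Q : Fin n → Bool) (g : Fin n → Fin n → Fin n) →
    (∀ x y → T (A x y) → T (Q (g x y))) →
    (∀ x y x' y' → T (A x y) → T (A x' y') → g x y ≡ g x' y' → x ≡ x' × y ≡ y') →
    countOrdered A ≤ count Q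
  countOrdered-injection A Q g A⇒Q g-injective = begin
    countOrdered A
      ≡⟨ ∑-cong (allFin n) (λ x → ∑-cong (allFin n) (λ y → 𝟙-fibres (A x y) (g x y))) ⟩
    ∑ (allFin n) (λ x → ∑ (allFin n) (λ y → ∑ (allFin n) (λ t → fibre t x y)))
      ≡⟨ ∑-cong (allFin n) (λ x → ∑-swap (allFin n) (allFin n) (λ y t → fibre t x y)) ⟩
    ∑ (allFin n) (λ x → ∑ (allFin n) (λ t → ∑ (allFin n) (fibre t x)))
      ≡⟨ ∑-swap (allFin n) (allFin n) (λ x t → ∑ (allFin n) (fibre t x)) ⟩
    ∑ (allFin n) (λ t → ∑ (allFin n) (λ x → ∑ (allFin n) (fibre t x)))
      ≤⟨ ∑-mono (allFin n) (λ t → ≤𝟙 (fibre≤1 t) (fibre-in-Q t)) ⟩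
    count Q ∎
    where
    open ≤-Reasoning
    fibre : Fin n → Fin n → Fin n → ℕ
    fibre t x y = 𝟙 (A x y ∧ (g x y == t))

    in-fibre : ∀ {t x y} → 1 ≤ fibre t x y → T (A x y) × g x y ≡ t
    in-fibre {t} {x} {y} p with a , g≡t ← T-∧⁻ {A x y} (𝟙-positive p) = a , ==⇒≡ g≡t

    fibre≤1 : ∀ t → ∑ (allFin n) (λ x → ∑ (allFin n) (fibre t x)) ≤ 1
    fibre≤1 t = ∑-atMostOne (allFin n) _ (allFin⁺ n)
      (λ x → ∑-atMostOne (allFin n) _ (allFin⁺ n) (λ y → 𝟙≤1 _) (same-y x))
      same-x
      where
      same : ∀ {x y x' y'} → 1 ≤ fibre t x y → 1 ≤ fibre t x' y' → x ≡ x' × y ≡ y'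
      same p p' with (a , refl) ← in-fibre p | (a' , g≡g') ← in-fibre p' =
        g-injective _ _ _ _ a a' (sym g≡g')
      same-y : ∀ x y y' → 1 ≤ fibre t x y → 1 ≤ fibre t x y' → y ≡ y'
      same-y x y y' p p' = proj₂ (same p p')
      same-x : ∀ x x' → 1 ≤ ∑ (allFin n) (fibre t x) → 1 ≤ ∑ (allFin n) (fibre t x') → x ≡ x'
      same-x x x' p p' with (y , q) ← ∑-positive (allFin n) _ p | (y' , q') ← ∑-positive (allFin n) _ p' =
        proj₁ (same q q')

    fibre-in-Q : ∀ t → 1 ≤ ∑ (allFin n) (λ x → ∑ (allFin n) (fibre t x)) → T (Q t)
    fibre-in-Q t p with (x , p') ← ∑-positive (allFin n) _ p
                    with (y , q) ← ∑-positive (allFin n) _ p'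
                    with (a , refl) ← in-fibre q = A⇒Q x y a

-- Walks

Unique-snoc : ∀ {A : Set} {xs : List A} {y} → Unique xs → All (_≢ y) xs → Unique (xs ++ y ∷ [])
Unique-snoc u xs≢y = AllPairs.++⁺ u ([] ∷ []) (All.map (_∷ []) xs≢y)

module _ {n : ℕ} {R : Fin n → Fin n → Set} where

  vertex : ∀ {u t k} → Walk R u t k → ℕ → Fin n
  vertex {u = u} _          zero    = u
  vertex {u = u} nil        (suc i) = u
  vertex         (cons _ w) (suc i) = vertex w i

  vertex-step : ∀ {u t k} (w : Walk R u t k) i → i < k → R (vertex w i) (vertex w (suc i))
  vertex-step (cons r w) zero    _       = r
  vertex-step (cons r w) (suc i) (s≤s p) = vertex-step w i p

  vertex-step∈walkEdges : ∀ {u t k} (w : Walk R u t k) i → i < k →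
                          (vertex w i , vertex w (suc i)) ∈ walkEdges w
  vertex-step∈walkEdges (cons r w) zero    _       = here refl
  vertex-step∈walkEdges (cons r w) (suc i) (s≤s p) = there (vertex-step∈walkEdges w i p)

  ∈walkEdges⇒vertex-step : ∀ {u t k} (w : Walk R u t k) {e} → e ∈ walkEdges w →
                           ∃ λ i → i < k × e ≡ (vertex w i , vertex w (suc i))
  ∈walkEdges⇒vertex-step (cons r w) (here refl) = 0 , s≤s z≤n , refl
  ∈walkEdges⇒vertex-step (cons r w) (there e∈)
    with i , i<k , refl ← ∈walkEdges⇒vertex-step w e∈ = suc i , s≤s i<k , refl

  takeWalk : ∀ {u t k} (w : Walk R u t k) i → i ≤ k → Walk R u (vertex w i) i
  takeWalk w          zero    _       = nil
  takeWalk (cons r w) (suc i) (s≤s p) = cons r (takeWalk w i p)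

  dropWalk : ∀ {u t k} (w : Walk R u t k) i → i ≤ k → Walk R (vertex w i) t (k ∸ i)
  dropWalk w          zero    _       = w
  dropWalk (cons r w) (suc i) (s≤s p) = dropWalk w i p

  _++ʷ_ : ∀ {a b c k l} → Walk R a b k → Walk R b c l → Walk R a c (k + l)
  nil      ++ʷ w' = w'
  cons r w ++ʷ w' = cons r (w ++ʷ w')

  vertsTail-++ : ∀ {a b c k l} (w : Walk R a b k) (w' : Walk R b c l) →
                 vertsTail (w ++ʷ w') ≡ vertsTail w ++ vertsTail w'
  vertsTail-++ nil        w' = refl
  vertsTail-++ (cons r w) w' = cong (_ ∷_) (vertsTail-++ w w')

  walkAlong : (f : ℕ → Fin n) (k : ℕ) → (∀ j → j < k → R (f j) (f (suc j))) → Walk R (f 0) (f k) k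
  walkAlong f zero    steps = nil
  walkAlong f (suc k) steps =
    cons (steps 0 (s≤s z≤n)) (walkAlong (f ∘ suc) k (λ j j<k → steps (suc j) (s≤s j<k)))

  Dist-unique : ∀ {s v a b} → Dist R s v a → Dist R s v b → a ≡ b
  Dist-unique (wa , a-min) (wb , b-min) = ≤-antisym (a-min _ wb) (b-min _ wa)

walk₀-≡ : ∀ {n} {R : Fin n → Fin n → Set} {a b} → Walk R a b 0 → a ≡ b
walk₀-≡ nil = refl

mapWalk : ∀ {n} {R R' : Fin n → Fin n → Set} → (∀ {a b} → R a b → R' a b) →
          ∀ {u t k} → Walk R u t k → Walk R' u t k
mapWalk f nil        = nil
mapWalk f (cons r w) = cons (f r) (mapWalk f w)

-- Bipartite graphs

Adj-sym : ∀ {n} (G : Graph n) {u v} → Adj G u v → Adj G v u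
Adj-sym G {u} {v} = subst T (Graph.sym G u v)

module _ {n : ℕ} (G : Graph n) (bipartite : Bipartite G) where

  private
    side = proj₁ bipartite

  side-step : ∀ {u v} → Adj G u v → side v ≡ not (side u)
  side-step {u} {v} a with side u | side v | proj₂ bipartite u v a
  ... | true  | true  | differ = ⊥-elim (differ refl)
  ... | true  | false | _      = refl
  ... | false | true  | _      = refl
  ... | false | false | differ = ⊥-elim (differ refl)

  side-along-walk : ∀ {u t k} → Walk (Adj G) u t k → side t ≡ iterate not (side u) k
  side-along-walk nil                = refl
  side-along-walk (cons {k = k} a w) =
    trans (side-along-walk w) (cong (λ c → iterate not c k) (side-step a))

  Adj-levels : ∀ {s u v a b} → Adj G u v → Dist (Adj G) s u a → Dist (Adj G) s v b →
               b ≡ suc a ⊎ a ≡ suc b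
  Adj-levels {s} {u} {v} {a} {b} uv (su , su-min) (sv , sv-min) with <-cmp a b
  ... | tri≈ _ refl _ =
    ⊥-elim (proj₂ bipartite u v uv (trans (side-along-walk su) (sym (side-along-walk sv))))
  ... | tri< a<b _ _ =
    inj₁ (≤-antisym (subst (b ≤_) (+-comm a 1) (sv-min _ (su ++ʷ cons uv nil))) a<b)
  ... | tri> _ _ b<a =
    inj₂ (≤-antisym (subst (a ≤_) (+-comm b 1) (su-min _ (sv ++ʷ cons (Adj-sym G uv) nil))) b<a)

-- Three level classes: two levels in one class differ by 0 or by at least 3.

mod3 : ℕ → Fin 3
mod3 0                   = zero
mod3 1                   = suc zero
mod3 2                   = suc (suc zero)
mod3 (suc (suc (suc k))) = mod3 k

mod3-suc : ∀ k → mod3 (suc k) ≢ mod3 k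
mod3-suc 0                   ()
mod3-suc 1                   ()
mod3-suc 2                   ()
mod3-suc (suc (suc (suc k))) = mod3-suc k

mod3-suc-suc : ∀ k → mod3 (suc (suc k)) ≢ mod3 k
mod3-suc-suc 0                   ()
mod3-suc-suc 1                   ()
mod3-suc-suc 2                   ()
mod3-suc-suc (suc (suc (suc k))) = mod3-suc-suc k

-- The trees T_s

edgeIs : ∀ {n} → Fin n → Fin n → Fin n × Fin n → Bool
edgeIs u v (x , y) = (x == u ∧ y == v) ∨ (x == v ∧ y == u)

edgeIs-forward : ∀ {n} (u v : Fin n) → T (edgeIs u v (u , v))
edgeIs-forward u v =
  T-∨⁺ˡ {u == u ∧ v == v} (T-∧⁺ {u == u} (==-refl u) (==-refl v))

edgeIs-backward : ∀ {n} (u v : Fin n) → T (edgeIs v u (u , v))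
edgeIs-backward u v =
  T-∨⁺ʳ (u == v ∧ v == u) (T-∧⁺ {u == u} (==-refl u) (==-refl v))

module _ {n : ℕ} {G : Graph n} {s t : Fin n} where

  onSchemePath⁺ : ∀ (b : Bool) (f : T b → ShortestPath G s t) (p : T b) {u v} →
                  T (onPath {G = G} (f p) u v) → T (onSchemePath {G = G} b f u v)
  onSchemePath⁺ true f p h = h

  onSchemePath⁻ : ∀ (b : Bool) (f : T b → ShortestPath G s t) {u v} →
                  T (onSchemePath {G = G} b f u v) → Σ (T b) λ p → T (onPath {G = G} (f p) u v)
  onSchemePath⁻ true f h = _ , h

module _ {n : ℕ} (G : Graph n) (P : Pairs n) (π : Scheme G P) where

  record Demand (s : Fin n) : Set where
    constructor demand
    field
      target   : Fin n
      demanded : T (P s target)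
  open Demand

  demand-≡ : ∀ {s} {q q' : Demand s} → target q ≡ target q' → q ≡ q'
  demand-≡ {q = demand t p} {demand .t p'} refl = cong (demand t) (T-irrelevant p p')

  len : ∀ {s} → Demand s → ℕ
  len {s} q = proj₁ (π s (target q) (demanded q))

  route : ∀ {s} (q : Demand s) → Walk (Adj G) s (target q) (len q)
  route {s} q = proj₁ (proj₂ (π s (target q) (demanded q)))

  node : ∀ {s} → Demand s → ℕ → Fin n
  node q = vertex (route q)

  Ts : Fin n → Fin n → Fin n → Set
  Ts = TsEdge G P π

  onRoute : Fin n → Fin n → Fin n → Fin n → Bool
  onRoute s u v t = onSchemePath {G = G} (P s t) (π s t) u v

  node-dist : ∀ {s} (q : Demand s) i → i ≤ len q → Dist (Adj G) s (node q i) i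
  node-dist {s} q i i≤len = takeWalk (route q) i i≤len , minimal
    where
    minimal : ∀ k → Walk (Adj G) s (node q i) k → i ≤ k
    minimal k w = +-cancelʳ-≤ (len q ∸ i) i k
      (subst (_≤ k + (len q ∸ i)) (sym (m+[n∸m]≡n i≤len))
        (proj₂ (proj₂ (π s (target q) (demanded q))) _ (w ++ʷ dropWalk (route q) i i≤len)))

  node-level-unique : ∀ {s} (q q' : Demand s) {i j} → i ≤ len q → j ≤ len q' →
                      node q i ≡ node q' j → i ≡ j
  node-level-unique q q' {i} {j} i≤ j≤ same =
    Dist-unique (node-dist q i i≤) (subst (λ v → Dist (Adj G) _ v j) (sym same) (node-dist q' j j≤))

  edge-on-route⇒Ts : ∀ {s} (q : Demand s) i → i < len q →
                     ∀ {u v} → T (edgeIs u v (node q i , node q (suc i))) → Ts s u v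
  edge-on-route⇒Ts {s} q i i<len {u} {v} matches = any-intro (onRoute s u v) (∈-allFin (target q))
    (onSchemePath⁺ (P s (target q)) (π s (target q)) (demanded q)
      (any-intro (edgeIs u v) (vertex-step∈walkEdges (route q) i i<len) matches))

  step⇒Ts : ∀ {s} (q : Demand s) i → i < len q → Ts s (node q i) (node q (suc i))
  step⇒Ts q i i<len = edge-on-route⇒Ts q i i<len (edgeIs-forward (node q i) (node q (suc i)))

  stepᵒᵖ⇒Ts : ∀ {s} (q : Demand s) i → i < len q → Ts s (node q (suc i)) (node q i)
  stepᵒᵖ⇒Ts q i i<len = edge-on-route⇒Ts q i i<len (edgeIs-backward (node q i) (node q (suc i)))

  Step : ∀ {s} → Demand s → ℕ → Fin n → Fin n → Set
  Step q i u v = i < len q × node q i ≡ u × node q (suc i) ≡ v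

  Ts⇒step : ∀ {s u v} → Ts s u v → ∃ λ (q : Demand s) → ∃ λ i → Step q i u v ⊎ Step q i v u
  Ts⇒step {s} {u} {v} h
    with t , _ , on-t ← any-elim (onRoute s u v) (allFin n) h
    with p , on-path ← onSchemePath⁻ (P s t) (π s t) on-t
    with _ , e∈ , matches ← any-elim (edgeIs u v) _ on-path
    with i , i<len , refl ← ∈walkEdges⇒vertex-step (route (demand t p)) e∈
    with T-∨⁻ (node (demand t p) i == u ∧ node (demand t p) (suc i) == v) matches
  ... | inj₁ uv = let x≡u , y≡v = T-∧⁻ {node (demand t p) i == u} uv in
                  demand t p , i , inj₁ (i<len , ==⇒≡ x≡u , ==⇒≡ y≡v)
  ... | inj₂ vu = let x≡v , y≡u = T-∧⁻ {node (demand t p) i == v} vu in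
                  demand t p , i , inj₂ (i<len , ==⇒≡ x≡v , ==⇒≡ y≡u)

  Ts⇒Adj : ∀ {s u v} → Ts s u v → Adj G u v
  Ts⇒Adj h with Ts⇒step h
  ... | q , i , inj₁ (i<len , refl , refl) = vertex-step (route q) i i<len
  ... | q , i , inj₂ (i<len , refl , refl) = Adj-sym G (vertex-step (route q) i i<len)

  node-distTs : ∀ {s} (q : Demand s) i → i ≤ len q → Dist (Ts s) s (node q i) i
  node-distTs q i i≤len =
    walkAlong (node q) i (λ j j<i → step⇒Ts q j (<-≤-trans j<i i≤len)) ,
    λ k w → proj₂ (node-dist q i i≤len) k (mapWalk Ts⇒Adj w)

  -- Two distinct nodes of one level are joined in T_s by a simple walk through lower levels;
  -- through a common child this would close up into a cycle, which is why parents are unique.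
  Below : Fin n → ℕ → Fin n → Fin n → Set
  Below s d b v = v ≡ b ⊎ ∃ λ j → j < d × Dist (Adj G) s v j

  SimpleWalkBelow : Fin n → ℕ → Fin n → Fin n → ℕ → Set
  SimpleWalkBelow s d a b k =
    Σ (Walk (Ts s) a b k) λ w → Unique (vertsTail w) × All (Below s d b) (vertsTail w)

  Below⇒≢ : ∀ {s d a b v} → Dist (Adj G) s a d → a ≢ b → Below s d b v → a ≢ v
  Below⇒≢ a-dist a≢b (inj₁ refl)                    = a≢b
  Below⇒≢ a-dist a≢b (inj₂ (j , j<d , v-dist)) refl = <⇒≢ j<d (Dist-unique v-dist a-dist)

  Below⇒≢-next : ∀ {s d b c v} → Dist (Adj G) s b d → Dist (Adj G) s c (suc d) → Below s d b v → v ≢ c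
  Below⇒≢-next {d = d} b-dist c-dist (inj₁ refl) refl = <⇒≢ (n<1+n d) (Dist-unique b-dist c-dist)
  Below⇒≢-next b-dist c-dist (inj₂ (j , j<d , v-dist)) refl =
    <⇒≢ (m<n⇒m<1+n j<d) (Dist-unique v-dist c-dist)

  Below-suc : ∀ {s d b c v} → Dist (Adj G) s b d → Below s d b v → Below s (suc d) c v
  Below-suc {d = d} b-dist (inj₁ refl)     = inj₂ (d , n<1+n d , b-dist)
  Below-suc b-dist (inj₂ (j , j<d , v-dist)) = inj₂ (j , m<n⇒m<1+n j<d , v-dist)

  SimpleWalkBelow-extend : ∀ {s d a a' b' b k} →
    Dist (Adj G) s a' d → Dist (Adj G) s b' d → Dist (Adj G) s b (suc d) →
    Ts s a a' → Ts s b' b → a' ≢ b' → SimpleWalkBelow s d a' b' k →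
    SimpleWalkBelow s (suc d) a b (suc (k + 1))
  SimpleWalkBelow-extend {s} {d} {a' = a'} {b' = b'} {b}
                         a'-dist b'-dist b-dist aa' b'b a'≢b' (w , unique , below) =
    cons aa' (w ++ʷ cons b'b nil) ,
    subst (λ vs → Unique (a' ∷ vs)) (sym (vertsTail-++ w _))
      (Allₚ.++⁺ (All.map (Below⇒≢ a'-dist a'≢b') below) (a'≢b ∷ []) ∷
       Unique-snoc unique (All.map (Below⇒≢-next b'-dist b-dist) below)) ,
    subst (λ vs → All (Below s (suc d) b) (a' ∷ vs)) (sym (vertsTail-++ w _))
      (inj₂ (d , n<1+n d , a'-dist) ∷ Allₚ.++⁺ (All.map (Below-suc b'-dist) below) (inj₁ refl ∷ []))
    where
    a'≢b : a' ≢ b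
    a'≢b refl = <⇒≢ (n<1+n d) (Dist-unique a'-dist b-dist)

  sameLevel-simpleWalk : ∀ {s} d (q q' : Demand s) → d ≤ len q → d ≤ len q' →
                         node q d ≢ node q' d → ∃ (SimpleWalkBelow s d (node q d) (node q' d))
  sameLevel-simpleWalk zero    q q' _ _ ne = ⊥-elim (ne refl)
  sameLevel-simpleWalk (suc d) q q' lt lt' _ with node q d ≟ node q' d
  ... | yes a'≡b' =
    2 , cons (stepᵒᵖ⇒Ts q d lt) (cons (subst (λ v → Ts _ v _) (sym a'≡b') (step⇒Ts q' d lt')) nil) ,
    ((a'≢b ∷ []) ∷ [] ∷ []) , (inj₂ (d , n<1+n d , a'-dist) ∷ inj₁ refl ∷ [])
    where
    a'-dist = node-dist q d (<⇒≤ lt)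
    a'≢b : node q d ≢ node q' (suc d)
    a'≢b same = <⇒≢ (n<1+n d) (Dist-unique a'-dist
      (subst (λ v → Dist (Adj G) _ v (suc d)) (sym same) (node-dist q' (suc d) lt')))
  ... | no a'≢b' =
    let k , walk = sameLevel-simpleWalk d q q' (<⇒≤ lt) (<⇒≤ lt') a'≢b' in
    suc (k + 1) ,
    SimpleWalkBelow-extend (node-dist q d (<⇒≤ lt)) (node-dist q' d (<⇒≤ lt')) (node-dist q' (suc d) lt')
                           (stepᵒᵖ⇒Ts q d lt) (step⇒Ts q' d lt') a'≢b' walk

  routeSteps : ∀ {s} → Demand s → (ℕ → Bool) → Fin n → Fin n → Bool
  routeSteps q φ x y = any (λ i → (node q i == x ∧ node q (suc i) == y) ∧ φ i) (upTo (len q))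

  isStep : Fin n → (ℕ → Bool) → Fin n → Fin n → Bool
  isStep s φ x y = any (λ t → guarded (P s t) (λ p → routeSteps (demand t p) φ x y)) (allFin n)

  IsStep : Fin n → (ℕ → Bool) → Fin n → Fin n → Set
  IsStep s φ x y = ∃ λ (q : Demand s) → ∃ λ i → Step q i x y × T (φ i)

  isStep⁺ : ∀ {s φ x y} → IsStep s φ x y → T (isStep s φ x y)
  isStep⁺ {s} {φ} {x} {y} (q , i , (i<len , refl , refl) , φi) =
    any-intro (λ t → guarded (P s t) (λ p → routeSteps (demand t p) φ x y)) (∈-allFin (target q))
      (guarded⁺ (P s (target q)) (λ p → routeSteps (demand (target q) p) φ x y) (demanded q)
        (any-intro (λ i → (node q i == x ∧ node q (suc i) == y) ∧ φ i) (∈-upTo⁺ i<len)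
          (T-∧⁺ {node q i == x ∧ node q (suc i) == y} (T-∧⁺ {node q i == x} (==-refl x) (==-refl y)) φi)))

  isStep⁻ : ∀ {s φ x y} → T (isStep s φ x y) → IsStep s φ x y
  isStep⁻ {s} {φ} {x} {y} h
    with t , _ , h₁ ← any-elim (λ t → guarded (P s t) (λ p → routeSteps (demand t p) φ x y)) (allFin n) h
    with p , h₂ ← guarded⁻ (P s t) (λ p → routeSteps (demand t p) φ x y) h₁
    with i , i∈ , h₃ ← any-elim _ (upTo (len (demand t p))) h₂
    with xy , φi ← T-∧⁻ {node (demand t p) i == x ∧ node (demand t p) (suc i) == y} h₃
    with x≡ , y≡ ← T-∧⁻ {node (demand t p) i == x} xy
    = demand t p , i , (∈-upTo⁻ i∈ , ==⇒≡ x≡ , ==⇒≡ y≡) , φi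

  isChild : Fin n → Fin n → Fin n → Bool
  isChild s = isStep s (λ _ → true)

  Child : Fin n → Fin n → Fin n → Set
  Child s = IsStep s (λ _ → true)

  isBranching : Fin n → Fin n → Bool
  isBranching s x =
    any (λ y → any (λ y' → (isChild s x y ∧ isChild s x y') ∧ not (y == y')) (allFin n)) (allFin n)

  isBranching⁺ : ∀ {s x y y'} → Child s x y → Child s x y' → y ≢ y' → T (isBranching s x)
  isBranching⁺ {s} {x} {y} {y'} c c' y≢y' =
    any-intro _ (∈-allFin y)
      (any-intro (λ y' → (isChild s x y ∧ isChild s x y') ∧ not (y == y')) (∈-allFin y')
        (T-∧⁺ {isChild s x y ∧ isChild s x y'} (T-∧⁺ {isChild s x y} (isStep⁺ c) (isStep⁺ c'))
              (not-does⁺ (y ≟ y') y≢y')))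

  isBranching⁻ : ∀ {s x} → T (isBranching s x) →
                 ∃ λ y → ∃ λ y' → Child s x y × Child s x y' × y ≢ y'
  isBranching⁻ {s} {x} h
    with y , _ , h₁ ← any-elim _ (allFin n) h
    with y' , _ , h₂ ← any-elim (λ y' → (isChild s x y ∧ isChild s x y') ∧ not (y == y')) (allFin n) h₁
    with cc' , y≢y' ← T-∧⁻ {isChild s x y ∧ isChild s x y'} h₂
    with c , c' ← T-∧⁻ {isChild s x y} cc'
    = y , y' , isStep⁻ c , isStep⁻ c' , not-does⁻ (y ≟ y') y≢y'

  step-oriented : ∀ {s} (q : Demand s) i → i < len q → Oriented (Ts s) s (node q i) (node q (suc i))
  step-oriented q i lt = step⇒Ts q i lt , i , node-distTs q i (<⇒≤ lt) , node-distTs q (suc i) lt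

  oriented-child : ∀ {s x y} → Oriented (Ts s) s x y → Child s x y
  oriented-child (xy , d , x-dist , y-dist) with Ts⇒step xy
  ... | q , i , inj₁ step = q , i , step , _
  ... | q , i , inj₂ (lt , refl , refl)
    with refl ← Dist-unique x-dist (node-distTs q (suc i) lt)
    = ⊥-elim (<⇒≢ (m<n⇒m<1+n (n<1+n i)) (sym (Dist-unique y-dist (node-distTs q i (<⇒≤ lt)))))

  isBranching-complete : ∀ {s x} → Branching (Ts s) s x → T (isBranching s x)
  isBranching-complete (y , y' , y≢y' , o , o') = isBranching⁺ (oriented-child o) (oriented-child o') y≢y'

  -- First targets

  routeVisits : ∀ {s} → Demand s → Fin n → Bool
  routeVisits q v = any (λ i → node q i == v) (upTo (suc (len q)))

  visits : Fin n → Fin n → Fin n → Bool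
  visits s v t = guarded (P s t) (λ p → routeVisits (demand t p) v)

  visits⁺ : ∀ {s} (q : Demand s) i → i ≤ len q → T (visits s (node q i) (target q))
  visits⁺ {s} q i i≤len =
    guarded⁺ (P s (target q)) (λ p → routeVisits (demand (target q) p) (node q i)) (demanded q)
      (any-intro (λ j → node q j == node q i) (∈-upTo⁺ (s≤s i≤len)) (==-refl (node q i)))

  visits⁻ : ∀ {s v t} → T (visits s v t) →
             Σ (T (P s t)) λ p → ∃ λ i → i ≤ len (demand t p) × node (demand t p) i ≡ v
  visits⁻ {s} {v} {t} h
    with p , h₁ ← guarded⁻ (P s t) (λ p → routeVisits (demand t p) v) h
    with i , i∈ , h₂ ← any-elim _ (upTo (suc (len (demand t p)))) h₁
    = p , i , ≤-pred (∈-upTo⁻ i∈) , ==⇒≡ h₂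

  firstTarget : Fin n → Fin n → Maybe (Fin n)
  firstTarget s v = findᵇ (visits s v) (allFin n)

  firstTarget-defined : ∀ {s} (q : Demand s) i → i ≤ len q → ∃ λ l → firstTarget s (node q i) ≡ just l
  firstTarget-defined q i i≤len =
    findᵇ-complete (visits _ (node q i)) (∈-allFin (target q)) (visits⁺ q i i≤len)

  firstTarget-demanded : ∀ {s v l} → firstTarget s v ≡ just l → T (P s l)
  firstTarget-demanded {s} {v} found = proj₁ (visits⁻ (findᵇ-sound (visits s v) (allFin n) found))

  firstTarget-on-route : ∀ {s} (q : Demand s) i (ql : Demand s) → i ≤ len q →
                         firstTarget s (node q i) ≡ just (target ql) → i ≤ len ql × node ql i ≡ node q i
  firstTarget-on-route {s} q i ql i≤len found
    with p , j , j≤ , same ← visits⁻ (findᵇ-sound (visits s (node q i)) (allFin n) found)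
    with refl ← node-level-unique (demand (target ql) p) q j≤ i≤len same
    with refl ← demand-≡ {q = demand (target ql) p} {ql} refl
    = j≤ , same

  firstTarget-level-injective : ∀ {s} (q₁ q₂ : Demand s) i → i ≤ len q₁ → i ≤ len q₂ →
                                firstTarget s (node q₁ i) ≡ firstTarget s (node q₂ i) →
                                node q₁ i ≡ node q₂ i
  firstTarget-level-injective q₁ q₂ i i≤₁ i≤₂ same
    with l , found ← firstTarget-defined q₁ i i≤₁
    = let ql = demand l (firstTarget-demanded found) in
      trans (sym (proj₂ (firstTarget-on-route q₁ i ql i≤₁ found)))
            (proj₂ (firstTarget-on-route q₂ i ql i≤₂ (trans (sym same) found)))

  branchingStep switchStep keepStep : Fin n → Fin n → Fin n → Bool
  branchingStep s x y = isChild s x y ∧ isBranching s x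
  switchStep    s x y = isChild s x y ∧ not (does (≡-dec _≟_ (firstTarget s y) (firstTarget s x)))
  keepStep      s x y = branchingStep s x y ∧ does (≡-dec _≟_ (firstTarget s y) (firstTarget s x))

  branchingEdge : Fin n → Fin n → Bool
  branchingEdge u v = any (λ s → branchingStep s u v) (allFin n)

  firstTarget-head : ∀ {s x y} → Child s x y → ∃ λ l → firstTarget s y ≡ just l
  firstTarget-head (q , i , (lt , _ , refl) , _) = firstTarget-defined q (suc i) lt

  -- The default y is junk: the head of a step always has a first target (firstTarget-head).
  headTarget : Fin n → Fin n → Fin n
  headTarget s y = fromMaybe y (firstTarget s y)

  headTarget-demanded : ∀ {s x y} → Child s x y → T (P s (headTarget s y))
  headTarget-demanded c with l , found ← firstTarget-head c rewrite found = firstTarget-demanded found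

  headTarget-injective : ∀ {s x y x' y'} → Child s x y → Child s x' y' →
                         headTarget s y ≡ headTarget s y' → firstTarget s y ≡ firstTarget s y'
  headTarget-injective c c' = fromMaybe-injective (firstTarget-head c) (firstTarget-head c')

  switchStep-view : ∀ {s x y} → T (switchStep s x y) → Child s x y × firstTarget s y ≢ firstTarget s x
  switchStep-view {s} {x} {y} h =
    let c , sw = T-∧⁻ {isChild s x y} h in
    isStep⁻ c , not-does⁻ (≡-dec _≟_ (firstTarget s y) (firstTarget s x)) sw

  keepStep-view : ∀ {s x y} → T (keepStep s x y) →
                  Child s x y × T (isBranching s x) × firstTarget s y ≡ firstTarget s x
  keepStep-view {s} {x} {y} h =
    let br , kept = T-∧⁻ {branchingStep s x y} h ; c , b = T-∧⁻ {isChild s x y} br in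
    isStep⁻ c , b , does⁻ (≡-dec _≟_ (firstTarget s y) (firstTarget s x)) kept

  sibling : Fin n → Fin n → Fin n → Fin n
  sibling s x y = fromMaybe y (findᵇ (λ z → isChild s x z ∧ not (z == y)) (allFin n))

  sibling-child : ∀ {s x} y → T (isBranching s x) → Child s x (sibling s x y) × sibling s x y ≢ y
  sibling-child {s} {x} y branching =
    let c , ≢y = T-∧⁻ {isChild s x z} {not (z == y)}
                      (fromMaybe-findᵇ other y (∈-allFin (proj₁ witness)) (proj₂ witness)) in
    isStep⁻ c , not-does⁻ (z ≟ y) ≢y
    where
    z = sibling s x y
    other : Fin n → Bool
    other z = isChild s x z ∧ not (z == y)
    witness : ∃ λ z → T (other z)
    witness = let ya , yb , ca , cb , ya≢yb = isBranching⁻ branching in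
              pick ya yb ca cb ya≢yb (ya ≟ y)
      where
      pick : ∀ ya yb → Child s x ya → Child s x yb → ya ≢ yb → Dec (ya ≡ y) → ∃ λ z → T (other z)
      pick ya yb ca cb ya≢yb (yes refl) =
        yb , T-∧⁺ {isChild s x yb} (isStep⁺ cb) (not-does⁺ (yb ≟ y) (ya≢yb ∘ sym))
      pick ya yb ca cb ya≢yb (no ya≢y) =
        ya , T-∧⁺ {isChild s x ya} (isStep⁺ ca) (not-does⁺ (ya ≟ y) ya≢y)

  -- The graphs H_r of non-branching steps

  isNbStep : Fin 3 → Fin n → Fin n → Fin n → Bool
  isNbStep r s x y = isStep s (λ i → mod3 i == r) x y ∧ not (isBranching s x)

  NbStep : Fin 3 → Fin n → Fin n → Fin n → Set
  NbStep r s x y = ∃ λ (q : Demand s) → ∃ λ i → Step q i x y × mod3 i ≡ r × ¬ T (isBranching s x)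

  isNbStep⁺ : ∀ {r s x y} → NbStep r s x y → T (isNbStep r s x y)
  isNbStep⁺ {r} {s} {x} {y} (q , i , step , class , ¬br) =
    T-∧⁺ {isStep s (λ i → mod3 i == r) x y} (isStep⁺ (q , i , step , does⁺ (mod3 i ≟ r) class))
         (not-does⁺ (T? (isBranching s x)) ¬br)

  isNbStep⁻ : ∀ {r s x y} → T (isNbStep r s x y) → NbStep r s x y
  isNbStep⁻ {r} {s} {x} {y} h =
    let st , ¬br = T-∧⁻ {isStep s (λ i → mod3 i == r) x y} h ; q , i , step , class = isStep⁻ st in
    q , i , step , does⁻ (mod3 i ≟ r) class , not-does⁻ (T? (isBranching s x)) ¬br

  NbStep⇒NonBranchingEdge : ∀ {r s x y} → NbStep r s x y → NonBranchingEdge (Ts s) s x y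
  NbStep⇒NonBranchingEdge (q , i , (lt , refl , refl) , _ , ¬br) =
    step-oriented q i lt , ¬br ∘ isBranching-complete

  isNbEdge : Fin 3 → Fin n → Fin n → Fin n → Bool
  isNbEdge r u v s = isNbStep r s u v ∨ isNbStep r s v u

  nbAdj : Fin 3 → Fin n → Fin n → Bool
  nbAdj r u v = any (isNbEdge r u v) (allFin n)

  nbAdj-sym : ∀ r u v → nbAdj r u v ≡ nbAdj r v u
  nbAdj-sym r u v = cong or (map-cong (λ s → ∨-comm (isNbStep r s u v) (isNbStep r s v u)) (allFin n))

  nbAdj-irrefl : ∀ r u → nbAdj r u u ≡ false
  nbAdj-irrefl r u = ¬T⇒≡false λ h →
    let s , _ , e = any-elim (isNbEdge r u u) (allFin n) h
        q , i , (lt , x≡ , y≡) , _ = isNbStep⁻ (subst T (∨-idem (isNbStep r s u u)) e) in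
    1+n≢n (node-level-unique q q lt (<⇒≤ lt) (trans y≡ (sym x≡)))

  nbGraph : Fin 3 → Graph n
  nbGraph r = record { adj = nbAdj r ; sym = nbAdj-sym r ; irrefl = nbAdj-irrefl r }

  nbEdge : Fin n → Fin n → Bool
  nbEdge u v = any (λ r → (toℕ u <ᵇ toℕ v) ∧ nbAdj r u v) (allFin 3)

  -- u is a junk value, used only for non-edges.
  colour : Fin 3 → Fin n → Fin n → Fin n
  colour r u v = fromMaybe u (findᵇ (isNbEdge r u v) (allFin n))

  colour-edge : ∀ {r u v} → T (nbAdj r u v) → T (isNbEdge r u v (colour r u v))
  colour-edge {r} {u} {v} h =
    let s , _ , e = any-elim (isNbEdge r u v) (allFin n) h in
    fromMaybe-findᵇ (isNbEdge r u v) u (∈-allFin s) e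

  colour-sym : ∀ {r u v} → T (nbAdj r u v) → colour r u v ≡ colour r v u
  colour-sym {r} {u} {v} h =
    let s , _ , e = any-elim (isNbEdge r u v) (allFin n) h
        l , found = findᵇ-complete (isNbEdge r u v) (∈-allFin s) e
        found' = trans (findᵇ-cong (allFin n) (λ s → ∨-comm (isNbStep r s v u) (isNbStep r s u v))) found in
    trans (cong (fromMaybe u) found) (sym (cong (fromMaybe v) found'))

  inClass : Fin 3 → Fin n → Fin n → Bool
  inClass r i v = any (λ u → nbAdj r u v ∧ (colour r u v == i)) (allFin n)

  coloured⇒inClass : ∀ {r i u v} → T (nbAdj r u v) → colour r u v ≡ i → T (inClass r i v)
  coloured⇒inClass {r} {i} {u} {v} h coloured-i =
    any-intro (λ a → nbAdj r a v ∧ (colour r a v == i)) (∈-allFin u)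
      (T-∧⁺ {nbAdj r u v} h (does⁺ (colour r u v ≟ i) coloured-i))

  NbStep⇒Child : ∀ {r s x y} → NbStep r s x y → Child s x y
  NbStep⇒Child (q , i , step , _) = q , i , step , _

  coloured⇒NbStep : ∀ {r i u v} → T (nbAdj r u v) → colour r u v ≡ i → NbStep r i u v ⊎ NbStep r i v u
  coloured⇒NbStep {r} {i} {u} {v} h refl with T-∨⁻ (isNbStep r (colour r u v) u v) (colour-edge h)
  ... | inj₁ out = inj₁ (isNbStep⁻ out)
  ... | inj₂ in′ = inj₂ (isNbStep⁻ in′)

  record ClassEdge (r : Fin 3) (i u : Fin n) : Set where
    field
      tail head : Fin n
      step      : NbStep r i tail head
      coloured  : colour r tail head ≡ i
      endpoint  : u ≡ tail ⊎ u ≡ head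

    level : ℕ
    level = proj₁ (proj₂ step)

    class : mod3 level ≡ r
    class = proj₁ (proj₂ (proj₂ (proj₂ step)))

    tail-dist : Dist (Adj G) i tail level
    tail-dist = let q , j , (lt , tail≡ , _) , _ = step in
                subst (λ v → Dist (Adj G) i v j) tail≡ (node-dist q j (<⇒≤ lt))

    head-dist : Dist (Adj G) i head (suc level)
    head-dist = let q , j , (lt , _ , head≡) , _ = step in
                subst (λ v → Dist (Adj G) i v (suc j)) head≡ (node-dist q (suc j) lt)

    dist-as-tail : u ≡ tail → Dist (Adj G) i u level
    dist-as-tail u≡ = subst (λ v → Dist (Adj G) i v level) (sym u≡) tail-dist

    dist-as-head : u ≡ head → Dist (Adj G) i u (suc level)
    dist-as-head u≡ = subst (λ v → Dist (Adj G) i v (suc level)) (sym u≡) head-dist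

  ClassEdge-colour : ∀ {r i u v} → T (nbAdj r u v) → colour r u v ≡ i → ClassEdge r i u × ClassEdge r i v
  ClassEdge-colour {r} {i} {u} {v} adj coloured-i with coloured⇒NbStep adj coloured-i
  ... | inj₁ st = record { step = st ; coloured = coloured-i ; endpoint = inj₁ refl } ,
                  record { step = st ; coloured = coloured-i ; endpoint = inj₂ refl }
  ... | inj₂ st = record { step = st ; coloured = coloured-vu ; endpoint = inj₂ refl } ,
                  record { step = st ; coloured = coloured-vu ; endpoint = inj₁ refl }
    where coloured-vu = trans (sym (colour-sym adj)) coloured-i

  inClass⇒ClassEdge : ∀ {r i u} → T (inClass r i u) → ClassEdge r i u
  inClass⇒ClassEdge {r} {i} {u} h =
    let a , _ , adj-col = any-elim (λ a → nbAdj r a u ∧ (colour r a u == i)) (allFin n) h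
        adj , is-i = T-∧⁻ {nbAdj r a u} adj-col in
    proj₂ (ClassEdge-colour adj (==⇒≡ is-i))

  open ClassEdge

  nbAdj⇒Adj : ∀ {r u v} → T (nbAdj r u v) → Adj G u v
  nbAdj⇒Adj {r} {u} {v} h =
    [ NbStep⇒Adj , Adj-sym G ∘ NbStep⇒Adj ] (coloured⇒NbStep {i = colour r u v} h refl)
    where
    NbStep⇒Adj : ∀ {s x y} → NbStep r s x y → Adj G x y
    NbStep⇒Adj (q , j , (lt , refl , refl) , _) = vertex-step (route q) j lt

  level-clash : ∀ {r i a b} (E : ClassEdge r i a) (E' : ClassEdge r i b) → level E' ≢ suc (level E)
  level-clash E E' eq =
    mod3-suc (level E) (trans (cong mod3 (sym eq)) (trans (class E') (sym (class E))))

  level-clash₂ : ∀ {r i a b} (E : ClassEdge r i a) (E' : ClassEdge r i b) →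
                 level E' ≢ suc (suc (level E))
  level-clash₂ E E' eq =
    mod3-suc-suc (level E) (trans (cong mod3 (sym eq)) (trans (class E') (sym (class E))))

  step-classified : ∀ {s} (q : Demand s) i → i < len q →
    T (branchingEdge (node q i) (node q (suc i))) ⊎ T (nbAdj (mod3 i) (node q i) (node q (suc i)))
  step-classified {s} q i lt = classify (T? (isBranching s x))
    where
    x = node q i
    y = node q (suc i)
    classify : Dec (T (isBranching s x)) → T (branchingEdge x y) ⊎ T (nbAdj (mod3 i) x y)
    classify (yes branching) = inj₁ (any-intro (λ s → branchingStep s x y) (∈-allFin s)
      (T-∧⁺ {isChild s x y} (isStep⁺ (q , i , (lt , refl , refl) , _)) branching))
    classify (no ¬branching) = inj₂ (any-intro (isNbEdge (mod3 i) x y) (∈-allFin s)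
      (T-∨⁺ˡ {isNbStep (mod3 i) s x y} (isNbStep⁺ (q , i , (lt , refl , refl) , refl , ¬branching))))

  Ts-edge-classified : ∀ {s u v} → Ts s u v →
    T (branchingEdge u v) ⊎ T (branchingEdge v u) ⊎ ∃ λ r → T (nbAdj r u v)
  Ts-edge-classified h with Ts⇒step h
  ... | q , i , inj₁ (lt , refl , refl) = map₂ (λ nb → inj₂ (mod3 i , nb)) (step-classified q i lt)
  ... | q , i , inj₂ (lt , refl , refl) =
    [ inj₂ ∘ inj₁ , (λ nb → inj₂ (inj₂ (mod3 i , subst T (nbAdj-sym (mod3 i) _ _) nb))) ]
      (step-classified q i lt)

  πP-edge-classified : ∀ {u v} → T (inπP G P π u v) →
    T (branchingEdge u v) ⊎ T (branchingEdge v u) ⊎ ∃ λ r → T (nbAdj r u v)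
  πP-edge-classified {u} {v} h =
    let _ , _ , h-s = any-elim (λ s → inπPs G P π s u v) (allFin n) h in Ts-edge-classified h-s

  module _ (acyclic : ∀ s → ¬ HasCycle (Ts s)) where

    parent-unique : ∀ {s} (q q' : Demand s) i → i < len q → i < len q' →
                    node q (suc i) ≡ node q' (suc i) → node q i ≡ node q' i
    parent-unique {s} q q' i lt lt' same with node q i ≟ node q' i
    ... | yes eq = eq
    ... | no ne with sameLevel-simpleWalk i q q' (<⇒≤ lt) (<⇒≤ lt') ne
    ... | zero  , w₀ , _ = ⊥-elim (ne (walk₀-≡ w₀))
    ... | suc k , walk =
      let cycle , unique , _ =
            SimpleWalkBelow-extend (node-dist q i (<⇒≤ lt)) (node-dist q' i (<⇒≤ lt')) (node-dist q (suc i) lt)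
                                   (stepᵒᵖ⇒Ts q i lt) (subst (Ts s _) (sym same) (step⇒Ts q' i lt')) ne walk in
      ⊥-elim (acyclic s (_ , _ , cycle , s≤s (s≤s (m≤n+m 1 k)) , unique))

    ancestors-agree : ∀ {s} (q q' : Demand s) k → k ≤ len q → k ≤ len q' →
                      node q k ≡ node q' k → ∀ i → i ≤ k → node q i ≡ node q' i
    ancestors-agree q q' zero    _  _   _    .zero z≤n = refl
    ancestors-agree q q' (suc k) le le' same i i≤1+k with m≤n⇒m<n∨m≡n i≤1+k
    ... | inj₂ refl      = same
    ... | inj₁ (s≤s i≤k) = ancestors-agree q q' k (<⇒≤ le) (<⇒≤ le')
                             (parent-unique q q' k le le' same) i i≤k

    firstTarget-descendant : ∀ {s} (q : Demand s) {i j} → i ≤ j → j ≤ len q →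
                             firstTarget s (node q i) ≡ just (target q) →
                             firstTarget s (node q j) ≡ just (target q)
    firstTarget-descendant {s} q {i} {j} i≤j j≤len found-i =
      findᵇ-⊆ (visits s (node q j)) (visits s (node q i)) (allFin n) inherits found-i (visits⁺ q j j≤len)
      where
      inherits : ∀ t → T (visits s (node q j) t) → T (visits s (node q i) t)
      inherits t h
        with p , j' , j'≤ , same ← visits⁻ h
        with refl ← node-level-unique (demand t p) q j'≤ j≤len same
        = subst (λ v → T (visits s v t)) (ancestors-agree (demand t p) q j j'≤ j≤len same i i≤j)
                (visits⁺ (demand t p) i (≤-trans i≤j j'≤))

    switch-above : ∀ {s} (q₁ q₂ : Demand s) i₁ i₂ → i₁ < len q₁ → i₂ < len q₂ →
      firstTarget s (node q₁ (suc i₁)) ≡ firstTarget s (node q₂ (suc i₂)) → i₁ < i₂ →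
      firstTarget s (node q₂ (suc i₂)) ≡ firstTarget s (node q₂ i₂)
    switch-above {s} q₁ q₂ i₁ i₂ lt₁ lt₂ same i₁<i₂
      with l , found-y₁ ← firstTarget-defined q₁ (suc i₁) lt₁
      = trans found-y₂ (sym found-x₂)
      where
      ql = demand l (firstTarget-demanded found-y₁)
      found-y₂ = trans (sym same) found-y₁
      y₁-on = firstTarget-on-route q₁ (suc i₁) ql lt₁ found-y₁
      y₂-on = firstTarget-on-route q₂ (suc i₂) ql lt₂ found-y₂
      found-x₂ : firstTarget s (node q₂ i₂) ≡ just l
      found-x₂ = subst (λ v → firstTarget s v ≡ just l)
        (parent-unique ql q₂ i₂ (proj₁ y₂-on) lt₂ (proj₂ y₂-on))
        (firstTarget-descendant ql i₁<i₂ (<⇒≤ (proj₁ y₂-on))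
          (subst (λ v → firstTarget s v ≡ just l) (sym (proj₂ y₁-on)) found-y₁))

    -- On the route to a target l the nodes with first target l form a final segment, so l
    -- determines the switch step into it.
    switch-injective : ∀ {s x₁ y₁ x₂ y₂} → Child s x₁ y₁ → Child s x₂ y₂ →
      firstTarget s y₁ ≢ firstTarget s x₁ → firstTarget s y₂ ≢ firstTarget s x₂ →
      firstTarget s y₁ ≡ firstTarget s y₂ → x₁ ≡ x₂ × y₁ ≡ y₂
    switch-injective (q₁ , i₁ , (lt₁ , refl , refl) , _) (q₂ , i₂ , (lt₂ , refl , refl) , _) sw₁ sw₂ same
      with <-cmp i₁ i₂
    ... | tri< i₁<i₂ _ _ = ⊥-elim (sw₂ (switch-above q₁ q₂ i₁ i₂ lt₁ lt₂ same i₁<i₂))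
    ... | tri> _ _ i₂<i₁ = ⊥-elim (sw₁ (switch-above q₂ q₁ i₂ i₁ lt₂ lt₁ (sym same) i₂<i₁))
    ... | tri≈ _ refl _  = parent-unique q₁ q₂ i₁ lt₁ lt₂ y₁≡y₂ , y₁≡y₂
      where y₁≡y₂ = firstTarget-level-injective q₁ q₂ (suc i₁) lt₁ lt₂ same

    child-firstTarget-injective : ∀ {s x y y'} → Child s x y → Child s x y' →
                                  firstTarget s y ≡ firstTarget s y' → y ≡ y'
    child-firstTarget-injective (q , i , (lt , refl , refl) , _) (q' , i' , (lt' , x≡ , refl) , _) same
      with refl ← node-level-unique q q' (<⇒≤ lt) (<⇒≤ lt') (sym x≡)
      = firstTarget-level-injective q q' (suc i) lt lt' same

    switchSteps≤ : ∀ s → countOrdered (switchStep s) ≤ count (P s)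
    switchSteps≤ s = countOrdered-injection (switchStep s) (P s) (λ x y → headTarget s y)
      (λ x y h → headTarget-demanded (proj₁ (switchStep-view h)))
      (λ x y x' y' h h' same →
        let c , sw = switchStep-view h ; c' , sw' = switchStep-view h' in
        switch-injective c c' sw sw' (headTarget-injective c c' same))

    -- A branching step that keeps the first target is charged to a switch step out of the same node.
    keepSteps≤ : ∀ s → countOrdered (keepStep s) ≤ count (P s)
    keepSteps≤ s = countOrdered-injection (keepStep s) (P s) (λ x y → headTarget s (sibling s x y))
      (λ x y h → headTarget-demanded (proj₁ (sibling-switch h)))
      (λ x y x' y' h h' same →
        let c , _ , kept = keepStep-view h ; c' , _ , kept' = keepStep-view h'
            z , z-switch = sibling-switch h ; z' , z'-switch = sibling-switch h'
            x≡x' = proj₁ (switch-injective z z' z-switch z'-switch (headTarget-injective z z' same))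
        in x≡x' , child-firstTarget-injective c (subst (λ v → Child s v y') (sym x≡x') c')
                    (trans kept (trans (cong (firstTarget s) x≡x') (sym kept'))))
      where
      sibling-switch : ∀ {x y} → T (keepStep s x y) →
                       Child s x (sibling s x y) × firstTarget s (sibling s x y) ≢ firstTarget s x
      sibling-switch {x} {y} h =
        let c , br , kept = keepStep-view h ; zc , z≢y = sibling-child y br in
        zc , λ same → z≢y (child-firstTarget-injective zc c (trans same (sym kept)))

    branchingSteps≤ : ∀ s → countOrdered (branchingStep s) ≤ count (P s) + count (P s)
    branchingSteps≤ s = begin
      countOrdered (branchingStep s)
        ≤⟨ countOrdered-mono (λ x y → split (isChild s x y) (isBranching s x)
                                            (does (≡-dec _≟_ (firstTarget s y) (firstTarget s x)))) ⟩
      countOrdered (λ x y → switchStep s x y ∨ keepStep s x y)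
        ≤⟨ countOrdered-∨ (switchStep s) (keepStep s) ⟩
      countOrdered (switchStep s) + countOrdered (keepStep s)
        ≤⟨ +-mono-≤ (switchSteps≤ s) (keepSteps≤ s) ⟩
      count (P s) + count (P s) ∎
      where
      open ≤-Reasoning
      split : ∀ a b c → T (a ∧ b) → T ((a ∧ not c) ∨ ((a ∧ b) ∧ c))
      split true true true  _ = _
      split true true false _ = _

    branchingEdges≤ : countOrdered branchingEdge ≤ countOrdered P + countOrdered P
    branchingEdges≤ = begin
      countOrdered branchingEdge                 ≤⟨ countOrdered-any (allFin n) branchingStep ⟩
      ∑ (allFin n) (countOrdered ∘ branchingStep) ≤⟨ ∑-mono (allFin n) branchingSteps≤ ⟩
      ∑ (allFin n) (λ s → count (P s) + count (P s)) ≡⟨ ∑-+ (allFin n) (count ∘ P) (count ∘ P) ⟩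
      countOrdered P + countOrdered P ∎
      where open ≤-Reasoning

    colourClass-matching : ∀ r i u v w → T (nbAdj r u v) → T (nbAdj r u w) →
                           colour r u v ≡ i → colour r u w ≡ i → v ≡ w
    colourClass-matching r i u v w h h' c c' = both (coloured⇒NbStep h c) (coloured⇒NbStep h' c')
      where
      in-out-clash : ∀ {a b} → NbStep r i a u → NbStep r i u b → ⊥
      in-out-clash (q , j , (lt , _ , refl) , class , _) (q' , j' , (lt' , u≡ , _) , class' , _)
        with refl ← node-level-unique q' q (<⇒≤ lt') lt u≡ = mod3-suc j (trans class' (sym class))
      both : NbStep r i u v ⊎ NbStep r i v u → NbStep r i u w ⊎ NbStep r i w u → v ≡ w
      both (inj₁ out@(_ , _ , _ , _ , ¬branching)) (inj₁ out') with v ≟ w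
      ... | yes v≡w = v≡w
      ... | no  v≢w = ⊥-elim (¬branching (isBranching⁺ (NbStep⇒Child out) (NbStep⇒Child out') v≢w))
      both (inj₂ in′) (inj₂ in″)
        with q , j , (lt , refl , refl) , _ ← in′ | q' , j' , (lt' , w≡ , u≡) , _ ← in″
        with refl ← node-level-unique q q' lt lt' (sym u≡)
        = trans (parent-unique q q' j lt lt' (sym u≡)) w≡
      both (inj₁ out) (inj₂ in′) = ⊥-elim (in-out-clash in′ out)
      both (inj₂ in′) (inj₁ out) = ⊥-elim (in-out-clash in′ out)

    module _ (bipartite : Bipartite G) (lazy : Lazy G P π) where

      lazy-forbids : ∀ {r i a b} (E : ClassEdge r i a) (E' : ClassEdge r i b) → level E ≡ level E' →
                     (tail E , head E) ≢ (tail E' , head E') → ¬ Adj G (tail E) (head E')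
      lazy-forbids {i = i} E E' same ne = proj₁ (proj₂ lazy i (tail E) (head E) (tail E') (head E')
        (NbStep⇒NonBranchingEdge (step E)) (NbStep⇒NonBranchingEdge (step E')) ne (level E)
        (head-dist E) (subst (λ d → Dist (Adj G) i (head E') (suc d)) (sym same) (head-dist E'))
        (tail-dist E) (subst (Dist (Adj G) i (tail E')) (sym same) (tail-dist E')))

      same-level-colour : ∀ {r i a b} (E : ClassEdge r i a) (E' : ClassEdge r i b) → level E ≡ level E' →
                          Adj G (tail E) (head E') → colour r (tail E) (head E') ≡ i
      same-level-colour {r} {i} E E' same adj with tail E ≟ tail E' | head E ≟ head E'
      ... | yes _  | yes h≡ = subst (λ v → colour r (tail E) v ≡ i) h≡ (coloured E)
      ... | yes _  | no  h≢ = ⊥-elim (lazy-forbids E E' same (h≢ ∘ cong proj₂) adj)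
      ... | no  t≢ | _      = ⊥-elim (lazy-forbids E E' same (t≢ ∘ cong proj₁) adj)

      colourClass-induced : ∀ {r i u v} → T (nbAdj r u v) → ClassEdge r i u → ClassEdge r i v →
                            colour r u v ≡ i
      colourClass-induced {r} {i} {u} {v} h E E' = by-endpoints (endpoint E) (endpoint E')
        where
        uv = nbAdj⇒Adj h
        by-endpoints : u ≡ tail E ⊎ u ≡ head E → v ≡ tail E' ⊎ v ≡ head E' → colour r u v ≡ i
        by-endpoints (inj₁ u≡) (inj₁ v≡) with Adj-levels G bipartite uv (dist-as-tail E u≡) (dist-as-tail E' v≡)
        ... | inj₁ eq = ⊥-elim (level-clash E E' eq)
        ... | inj₂ eq = ⊥-elim (level-clash E' E eq)
        by-endpoints (inj₁ u≡) (inj₂ v≡) with Adj-levels G bipartite uv (dist-as-tail E u≡) (dist-as-head E' v≡)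
        ... | inj₁ eq = subst₂ (λ a b → colour r a b ≡ i) (sym u≡) (sym v≡)
                          (same-level-colour E E' (sym (suc-injective eq)) (subst₂ (Adj G) u≡ v≡ uv))
        ... | inj₂ eq = ⊥-elim (level-clash₂ E' E eq)
        by-endpoints (inj₂ u≡) (inj₁ v≡) with Adj-levels G bipartite uv (dist-as-head E u≡) (dist-as-tail E' v≡)
        ... | inj₁ eq = ⊥-elim (level-clash₂ E E' eq)
        ... | inj₂ eq = trans (colour-sym h) (subst₂ (λ a b → colour r a b ≡ i) (sym v≡) (sym u≡)
                          (same-level-colour E' E (sym (suc-injective eq)) (subst₂ (Adj G) v≡ u≡ (Adj-sym G uv))))
        by-endpoints (inj₂ u≡) (inj₂ v≡) with Adj-levels G bipartite uv (dist-as-head E u≡) (dist-as-head E' v≡)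
        ... | inj₁ eq = ⊥-elim (level-clash E E' (suc-injective eq))
        ... | inj₂ eq = ⊥-elim (level-clash E' E (suc-injective eq))

      nbGraph-isRS : ∀ r → IsRS (nbGraph r)
      nbGraph-isRS r =
        (λ u v _ → colour r u v) ,
        (λ u v h _ → colour-sym h) ,
        λ i → (λ u v w → colourClass-matching r i u v w) ,
              inClass r i ,
              λ u v h →
                mk⇔ (λ (iu , iv) → colourClass-induced h (inClass⇒ClassEdge iu) (inClass⇒ClassEdge iv))
                    (λ coloured-i →
                      coloured⇒inClass (subst T (nbAdj-sym r u v) h) (trans (sym (colour-sym h)) coloured-i) ,
                      coloured⇒inClass h coloured-i)

      nbEdges≤ : ∀ m → (∀ (H : Graph n) → IsRS H → edgeCount H ≤ m) → countOrdered nbEdge ≤ 3 * m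
      nbEdges≤ m H≤m = begin
        countOrdered nbEdge
          ≤⟨ countOrdered-any (allFin 3) (λ r u v → (toℕ u <ᵇ toℕ v) ∧ nbAdj r u v) ⟩
        ∑ (allFin 3) (λ r → edgeCount (nbGraph r))
          ≤⟨ ∑-mono (allFin 3) (λ r → H≤m (nbGraph r) (nbGraph-isRS r)) ⟩
        3 * m ∎
        where open ≤-Reasoning

      πP-edges≤ : ∀ m → (∀ (H : Graph n) → IsRS H → edgeCount H ≤ m) →
                  countPairs (inπP G P π) ≤ 4 * (countOrdered P + m)
      πP-edges≤ m H≤m = begin
        countPairs (inπP G P π)
          ≤⟨ countOrdered-mono {g = λ u v → branchingEdge u v ∨ (branchingEdge v u ∨ nbEdge u v)}
               (λ u v h → let u<v , e = T-∧⁻ {toℕ u <ᵇ toℕ v} h in covered u<v (πP-edge-classified e)) ⟩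
        countOrdered (λ u v → branchingEdge u v ∨ (branchingEdge v u ∨ nbEdge u v))
          ≤⟨ countOrdered-∨ branchingEdge (λ u v → branchingEdge v u ∨ nbEdge u v) ⟩
        countOrdered branchingEdge + countOrdered (λ u v → branchingEdge v u ∨ nbEdge u v)
          ≤⟨ +-monoʳ-≤ (countOrdered branchingEdge) (countOrdered-∨ (λ u v → branchingEdge v u) nbEdge) ⟩
        countOrdered branchingEdge + (countOrdered (λ u v → branchingEdge v u) + countOrdered nbEdge)
          ≡⟨ cong (λ k → countOrdered branchingEdge + (k + countOrdered nbEdge))
                  (countOrdered-flip branchingEdge) ⟩
        countOrdered branchingEdge + (countOrdered branchingEdge + countOrdered nbEdge)
          ≤⟨ +-mono-≤ branchingEdges≤ (+-mono-≤ branchingEdges≤ (nbEdges≤ m H≤m)) ⟩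
        (p + p) + ((p + p) + 3 * m)
          ≤⟨ m≤m+n _ m ⟩
        (p + p) + ((p + p) + 3 * m) + m
          ≡⟨ arithmetic p m ⟩
        4 * (p + m) ∎
        where
        open ≤-Reasoning
        p = countOrdered P
        covered : ∀ {u v} → T (toℕ u <ᵇ toℕ v) →
                  T (branchingEdge u v) ⊎ T (branchingEdge v u) ⊎ ∃ (λ r → T (nbAdj r u v)) →
                  T (branchingEdge u v ∨ (branchingEdge v u ∨ nbEdge u v))
        covered u<v (inj₁ b)                = T-∨⁺ˡ b
        covered u<v (inj₂ (inj₁ b))         = T-∨⁺ʳ (branchingEdge _ _) (T-∨⁺ˡ b)
        covered {u} {v} u<v (inj₂ (inj₂ (r , nb))) =
          T-∨⁺ʳ (branchingEdge u v) (T-∨⁺ʳ (branchingEdge v u)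
            (any-intro (λ r → (toℕ u <ᵇ toℕ v) ∧ nbAdj r u v) (∈-allFin r)
                       (T-∧⁺ {toℕ u <ᵇ toℕ v} u<v nb)))
        arithmetic : ∀ p m → (p + p) + ((p + p) + 3 * m) + m ≡ 4 * (p + m)
        arithmetic = solve-∀

lemma4 : ∃ λ (C : ℕ) →
    ∀ n (G : Graph n) → Bipartite G →
    ∀ (P : Pairs n) (π : Scheme G P) → Lazy G P π →
    ∀ (m : ℕ) → (∀ (H : Graph n) → IsRS H → edgeCount H ≤ m) →
    countPairs (inπP G P π) ≤ C * (countOrdered P + m)
lemma4 = 4 , λ n G bipartite P π lazy → πP-edges≤ G P π (λ s → proj₂ (proj₁ lazy s)) bipartite lazy
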